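{- Let $\mathbb{P}$ and $\mathbb{V}$ be algebraic theories, with $\mathbb{P}$ consistent, let $T_{\mathbb{P}}$ be a stable universal set of $\mathbb{P}$-terms and $T_{\mathbb{V}}$ a stable universal set of $\mathbb{V}$-terms. Suppose there are terms $m \vdash_{\mathbb{P}} p$ and $n \vdash_{\mathbb{V}} v$ such that: (P4) there is a fixed-point free permutation $\sigma$ of $\{1,\dots,m\}$ with $m \vdash p =_{\mathbb{P}} p[\sigma]$; (P5) $1 \vdash p[1/i] =_{\mathbb{P}} 1$, where $1$ is substituted for every variable $i$; (P6) for all $p' \in T_{\mathbb{P}}$: if $\Gamma \vdash p =_{\mathbb{P}} p'$ then $m \vdash p'$; (V4) $1 \vdash v[1/i] =_{\mathbb{V}} 1$, where $1$ is substituted for every variable $i$; (V5) for all $v' \in T_{\mathbb{V}}$ and every variable $i$: if $\Gamma \vdash i =_{\mathbb{V}} v'$ then $\{i\} \vdash v'$; (V6) for all $v' \in T_{\mathbb{V}}$: if $\Gamma \vdash v =_{\mathbb{V}} v'$ then there is no variable $i \in \Gamma$ with $\{i\} \vdash v'$. Then there is no composite theory of $\mathbb{P}$ after $\mathbb{V}$.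
   Context: An algebraic theory consists of a signature and equations; $=_{\mathbb T}$ is provable equality in equational logic. Variables are natural numbers and the number $n$ also denotes $\{1,\dots,n\}$; $Y \vdash t$ means all variables of $t$ lie in $Y$; $\Gamma$ is an arbitrary variable context. $p[\sigma]$ is $p$ with each variable $i$ renamed to $\sigma(i)$. A theory is consistent if it does not prove $x=y$ for distinct variables. A set of terms is universal if every term is provably equal to a member, and stable if closed under substituting variables for variables. For theories $\mathbb{S},\mathbb{T}$ (here $\mathbb{T}=\mathbb{P}$, $\mathbb{S}=\mathbb{V}$): $\mathbb{U}$ contains them if its signature contains both signatures and their equations are provable in $\mathbb{U}$; a separated term is $t[s_x/x]$ with $t$ a $\mathbb{T}$-term with variables in $X$ and each $s_x$ an $\mathbb{S}$-term; separated terms $t[s_x/x]$, $t'[s'_{x'}/x']$ are equal modulo $(\mathbb{T},\mathbb{S})$ if there are $f:X\to Y$, $f':X'\to Y$ and $\mathbb{S}$-terms $\bar s_y$ with $t[f(x)/x]=_{\mathbb T}t'[f'(x')/x']$, $s_x=_{\mathbb S}\bar s_{f(x)}$, $s'_{x'}=_{\mathbb S}\bar s_{f'(x')}$; $\mathbb{U}$ is a composite theory of $\mathbb{T}$ after $\mathbb{S}$ if every $\mathbb U$-term is $\mathbb U$-equal to a separated term and any two separated terms $\mathbb U$-equal to a common term are equal modulo $(\mathbb{T},\mathbb{S})$. -}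

module Defs where

open import Data.Nat using (ℕ; _≤_)
open import Data.Fin using (Fin)
open import Data.List using (List)
open import Data.List.Membership.Propositional using (_∈_)
open import Data.Product using (Σ; ∃; _×_; _,_)
open import Relation.Binary.PropositionalEquality using (_≡_; _≢_; subst)
open import Relation.Nullary using (¬_)
open import Function using (_∘_)

record Signature : Set₁ where
  field
    Op    : Set
    arity : Op → ℕ
open Signature public

data Term (S : Signature) : Set where
  var : ℕ → Term S
  op  : (o : Op S) → (Fin (arity S o) → Term S) → Term S

infixl 30 _[_]

_[_] : ∀ {S} → Term S → (ℕ → Term S) → Term S
var x [ ρ ] = ρ x
op o ts [ ρ ] = op o (λ i → ts i [ ρ ])

rename : ∀ {S} → (ℕ → ℕ) → Term S → Term S
rename σ t = t [ var ∘ σ ]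

data _occursIn_ {S : Signature} (x : ℕ) : Term S → Set where
  here  : x occursIn var x
  under : ∀ {o ts} (i : Fin (arity S o)) → x occursIn ts i → x occursIn op o ts

infix 4 _⊢_
_⊢_ : ∀ {S} → (ℕ → Set) → Term S → Set
Y ⊢ t = ∀ x → x occursIn t → Y x

-- the number n as the context {1,…,n}
⟪_⟫ : ℕ → ℕ → Set
⟪ n ⟫ x = (1 ≤ x) × (x ≤ n)

｛_｝ : ℕ → ℕ → Set
｛ i ｝ x = x ≡ i

record Theory : Set₁ where
  field
    sig : Signature
    Ax  : Term sig → Term sig → Set
open Theory public

infix 4 _⊢_≈_
data _⊢_≈_ (T : Theory) : Term (sig T) → Term (sig T) → Set where
  ax     : ∀ {l r} → Ax T l r → (ρ : ℕ → Term (sig T)) → T ⊢ l [ ρ ] ≈ r [ ρ ]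
  ≈refl  : ∀ {t} → T ⊢ t ≈ t
  ≈sym   : ∀ {t u} → T ⊢ t ≈ u → T ⊢ u ≈ t
  ≈trans : ∀ {t u w} → T ⊢ t ≈ u → T ⊢ u ≈ w → T ⊢ t ≈ w
  ≈cong  : ∀ o {ts us} → (∀ i → T ⊢ ts i ≈ us i) → T ⊢ op o ts ≈ op o us

Consistent : Theory → Set
Consistent T = ∀ x y → x ≢ y → ¬ (T ⊢ var x ≈ var y)

Universal : (T : Theory) → (Term (sig T) → Set) → Set
Universal T A = ∀ t → ∃ λ t' → A t' × (T ⊢ t ≈ t')

Stable : (T : Theory) → (Term (sig T) → Set) → Set
Stable T A = ∀ t (ρ : ℕ → ℕ) → A t → A (rename ρ t)

record SigIncl (S S' : Signature) : Set where
  field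
    f     : Op S → Op S'
    pres  : ∀ o → arity S' (f o) ≡ arity S o
    inj   : ∀ o o' → f o ≡ f o' → o ≡ o'
open SigIncl public

translate : ∀ {S S'} → SigIncl S S' → Term S → Term S'
translate ι (var x) = var x
translate ι (op o ts) = op (f ι o) (λ i → translate ι (ts (subst Fin (pres ι o) i)))

record Contains (U T : Theory) : Set where
  field
    incl  : SigIncl (sig T) (sig U)
    eqns  : ∀ l r → Ax T l r → U ⊢ translate incl l ≈ translate incl r
open Contains public

-- t[s_x/x] : t a 𝕋-term with variables in the finite set X, s_x 𝕊-terms
-- (s is only relevant on X)
record Separated (T S : Theory) : Set where
  field
    X   : List ℕ
    t   : Term (sig T)
    tX  : (λ x → x ∈ X) ⊢ t
    s   : ℕ → Term (sig S)
open Separated public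

⟦_⟧ : ∀ {U T S} → Separated T S → Contains U T → Contains U S → Term (sig U)
⟦ st ⟧ cT cS = translate (incl cT) (t st) [ translate (incl cS) ∘ s st ]

-- equality modulo (𝕋,𝕊); the codomain Y of f, f' is taken to be all variables
EqualModulo : (T S : Theory) → Separated T S → Separated T S → Set
EqualModulo T S st st' =
  Σ (ℕ → ℕ) λ f → Σ (ℕ → ℕ) λ f' → Σ (ℕ → Term (sig S)) λ sbar →
    (T ⊢ rename f (t st) ≈ rename f' (t st'))
    × (∀ x → x ∈ X st → S ⊢ s st x ≈ sbar (f x))
    × (∀ x → x ∈ X st' → S ⊢ s st' x ≈ sbar (f' x))

IsComposite : (U T S : Theory) → Set
IsComposite U T S =
  Σ (Contains U T) λ cT → Σ (Contains U S) λ cS →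
    (∀ (u : Term (sig U)) → ∃ λ (st : Separated T S) → U ⊢ u ≈ ⟦ st ⟧ cT cS)
    × (∀ (st st' : Separated T S) (u : Term (sig U)) →
         U ⊢ u ≈ ⟦ st ⟧ cT cS → U ⊢ u ≈ ⟦ st' ⟧ cT cS → EqualModulo T S st st')

-- Suppose U were a composite of P after V and look at u = v[p(x_{k,1},…,x_{k,m})/k], a grid of
-- variables with one row per variable k of v.  Separate u as t[s_x/x].  Renaming every x_{k,i}
-- to i or to σ(i), row by row, turns u into p (by P4 and V4), so by uniqueness of separations,
-- P6 and V5 every s_x is sent to a single variable of p by each such renaming; since σ has no
-- fixed point, this forces all variables of s_x into one row.  Renaming x_{k,i} to k instead
-- turns u into v (by P5); as P is consistent, v is then V-equal to some s_x with its row
-- collapsed to a single variable, which contradicts V6.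
module Submission where

open import Defs
open import Data.Nat using (ℕ; _≤_; zero; suc; _+_; _*_; z≤n; s≤s; _<_; _≟_; _/_; _%_)
open import Data.Nat.Properties using (≤-refl; ≤-pred; ≤∧≢⇒<; m≤n⇒m≤1+n; 1+n≢n)
open import Data.Nat.DivMod using (m<n⇒m%n≡m; [m+kn]%n≡m%n; +-distrib-/-∣ʳ; m<n⇒m/n≡0; m*n/n≡m)
open import Data.Nat.Divisibility using (n∣m*n)
open import Data.Bool using (Bool; true; false; if_then_else_)
open import Data.Fin using (Fin)
open import Data.List using (List; []; _∷_; concat; map; allFin; upTo)
open import Data.List.Membership.Propositional using (_∈_; find; lose)
open import Data.List.Membership.Propositional.Properties
  using (∉[]; ∈-map⁺; ∈-map⁻; ∈-concat⁺′; ∈-concat⁻′; ∈-allFin; ∈-upTo⁺)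
open import Data.List.Relation.Unary.Any using (here; any?)
open import Data.Product using (Σ; ∃; _×_; _,_; proj₁; proj₂)
open import Data.Empty using (⊥-elim)
open import Relation.Binary.Bundles using (Setoid)
open import Relation.Binary.PropositionalEquality
  using (_≡_; _≢_; refl; sym; trans; cong; cong₂; subst; module ≡-Reasoning)
open import Relation.Nullary using (¬_; yes; no; does)
open import Relation.Nullary.Decidable using (dec-true; dec-false; decidable-stable)
open import Function using (_∘_; const)

≈-setoid : Theory → Setoid _ _
≈-setoid T = record
  { Carrier       = Term (sig T)
  ; _≈_           = T ⊢_≈_
  ; isEquivalence = record { refl = ≈refl ; sym = ≈sym ; trans = ≈trans }
  }

module _ {T : Theory} where

  ≈-reflexive : ∀ {a b : Term (sig T)} → a ≡ b → T ⊢ a ≈ b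
  ≈-reflexive refl = ≈refl

  subst-cong : ∀ (t : Term (sig T)) {ρ ρ' : ℕ → Term (sig T)} →
    (∀ x → x occursIn t → T ⊢ ρ x ≈ ρ' x) → T ⊢ t [ ρ ] ≈ t [ ρ' ]
  subst-cong (var x)   eq = eq x here
  subst-cong (op o ts) eq = ≈cong o (λ i → subst-cong (ts i) (λ x occ → eq x (under i occ)))

  subst-subst : ∀ (t : Term (sig T)) (ρ ρ' : ℕ → Term (sig T)) →
    T ⊢ t [ ρ ] [ ρ' ] ≈ t [ (λ x → ρ x [ ρ' ]) ]
  subst-subst (var x)   ρ ρ' = ≈refl
  subst-subst (op o ts) ρ ρ' = ≈cong o (λ i → subst-subst (ts i) ρ ρ')

  subst-var : ∀ (t : Term (sig T)) → T ⊢ t [ var ] ≈ t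
  subst-var (var x)   = ≈refl
  subst-var (op o ts) = ≈cong o (λ i → subst-var (ts i))

  ≈-subst : ∀ {a b} → T ⊢ a ≈ b → ∀ ρ → T ⊢ a [ ρ ] ≈ b [ ρ ]
  ≈-subst (ax {l} {r} l=r ρ₀) ρ =
    ≈trans (subst-subst l ρ₀ ρ) (≈trans (ax l=r _) (≈sym (subst-subst r ρ₀ ρ)))
  ≈-subst ≈refl          ρ = ≈refl
  ≈-subst (≈sym e)       ρ = ≈sym (≈-subst e ρ)
  ≈-subst (≈trans e e')  ρ = ≈trans (≈-subst e ρ) (≈-subst e' ρ)
  ≈-subst (≈cong o es)   ρ = ≈cong o (λ i → ≈-subst (es i) ρ)

module _ {S : Signature} where

  occursIn-rename⁺ : ∀ (g : ℕ → ℕ) (t : Term S) {y} → y occursIn t → g y occursIn rename g t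
  occursIn-rename⁺ g (var x)   here          = here
  occursIn-rename⁺ g (op o ts) (under i occ) = under i (occursIn-rename⁺ g (ts i) occ)

  occursIn-rename⁻ : ∀ (g : ℕ → ℕ) (t : Term S) {z} → z occursIn rename g t →
    ∃ λ y → y occursIn t × g y ≡ z
  occursIn-rename⁻ g (var x)   here = x , here , refl
  occursIn-rename⁻ g (op o ts) (under i occ) with occursIn-rename⁻ g (ts i) occ
  ... | y , y∈t , gy≡z = y , under i y∈t , gy≡z

  varsOf : Term S → List ℕ
  varsOf (var x)   = x ∷ []
  varsOf (op o ts) = concat (map (λ i → varsOf (ts i)) (allFin (arity S o)))

  varsOf-complete : ∀ (t : Term S) {x} → x occursIn t → x ∈ varsOf t
  varsOf-complete (var x)   here          = here refl
  varsOf-complete (op o ts) (under i occ) =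
    ∈-concat⁺′ (varsOf-complete (ts i) occ) (∈-map⁺ (λ j → varsOf (ts j)) (∈-allFin i))

  varsOf-sound : ∀ (t : Term S) {x} → x ∈ varsOf t → x occursIn t
  varsOf-sound (var x) (here refl) = here
  varsOf-sound (op o ts) x∈ts with ∈-concat⁻′ (map (λ i → varsOf (ts i)) (allFin (arity S o))) x∈ts
  ... | _ , x∈xs , xs∈tss with ∈-map⁻ (λ i → varsOf (ts i)) xs∈tss
  ... | i , _ , refl = under i (varsOf-sound (ts i) x∈xs)

  constant-rename⇒singleton : ∀ (g : ℕ → ℕ) (t : Term S) →
    (∀ {y y'} → y occursIn t → y' occursIn t → g y ≡ g y') → ∃ λ k → ｛ k ｝ ⊢ rename g t
  constant-rename⇒singleton g t g-const with varsOf t | varsOf-sound t | varsOf-complete t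
  ... | [] | _ | complete = 0 , λ z occ →
    ⊥-elim (∉[] (complete (proj₁ (proj₂ (occursIn-rename⁻ g t occ)))))
  ... | y₀ ∷ _ | sound | _ = g y₀ , λ z occ →
    let y , y∈t , gy≡z = occursIn-rename⁻ g t occ in trans (sym gy≡z) (g-const y∈t (sound (here refl)))

Consistent⇒var≉ : ∀ {T : Theory} → Consistent T → ∀ {a} {t : Term (sig T)} →
  ¬ (a occursIn t) → ¬ (T ⊢ var a ≈ t)
Consistent⇒var≉ {T} consistent {a} {t} a∉t a≈t =
  consistent (suc a) a 1+n≢n (begin
    var (suc a)               ≡⟨ cong var (sym bump-a) ⟩
    var a [ var ∘ bump ]      ≈⟨ ≈-subst a≈t (var ∘ bump) ⟩
    t [ var ∘ bump ]          ≈⟨ subst-cong t (λ z z∈t → ≈-reflexive (cong var (bump-fixes-t z z∈t))) ⟩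
    t [ var ]                 ≈⟨ subst-var t ⟩
    t                         ≈⟨ ≈sym a≈t ⟩
    var a                     ∎)
  where
    open import Relation.Binary.Reasoning.Setoid (≈-setoid T)
    bump : ℕ → ℕ
    bump z = if does (z ≟ a) then suc a else z
    bump-a : bump a ≡ suc a
    bump-a rewrite dec-true (a ≟ a) refl = refl
    bump-fixes-t : ∀ z → z occursIn t → bump z ≡ z
    bump-fixes-t z z∈t rewrite dec-false (z ≟ a) (λ { refl → a∉t z∈t }) = refl

occursIn-translate⁻ : ∀ {S S'} (ι : SigIncl S S') (t : Term S) {x} →
  x occursIn translate ι t → x occursIn t
occursIn-translate⁻ ι (var x)   here          = here
occursIn-translate⁻ ι (op o ts) (under i occ) = under _ (occursIn-translate⁻ ι (ts _) occ)

translate-subst : ∀ {U : Theory} {S} (ι : SigIncl S (sig U)) (t : Term S) (ρ : ℕ → Term S) →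
  U ⊢ translate ι (t [ ρ ]) ≈ translate ι t [ translate ι ∘ ρ ]
translate-subst ι (var x)   ρ = ≈refl
translate-subst ι (op o ts) ρ = ≈cong (f ι o) (λ i → translate-subst ι (ts (subst Fin (pres ι o) i)) ρ)

translate-≈ : ∀ {U T} (c : Contains U T) {a b} → T ⊢ a ≈ b →
  U ⊢ translate (incl c) a ≈ translate (incl c) b
translate-≈ c (ax {l} {r} l=r ρ) =
  ≈trans (translate-subst (incl c) l ρ)
    (≈trans (≈-subst (eqns c l r l=r) _) (≈sym (translate-subst (incl c) r ρ)))
translate-≈ c ≈refl         = ≈refl
translate-≈ c (≈sym e)      = ≈sym (translate-≈ c e)
translate-≈ c (≈trans e e') = ≈trans (translate-≈ c e) (translate-≈ c e')
translate-≈ c (≈cong o es)  = ≈cong (f (incl c) o) (λ i → translate-≈ c (es (subst Fin (pres (incl c) o) i)))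

translate-subst-const : ∀ {U T} (c : Contains U T) t → T ⊢ rename (λ _ → 1) t ≈ var 1 →
  ∀ w → U ⊢ translate (incl c) t [ (λ _ → w) ] ≈ w
translate-subst-const {U} c t t[1]≈1 w = begin
  ιt [ (λ _ → w) ]                     ≈⟨ ≈sym (subst-subst ιt (λ _ → var 1) (λ _ → w)) ⟩
  ιt [ (λ _ → var 1) ] [ (λ _ → w) ]   ≈⟨ ≈-subst (≈sym (translate-subst (incl c) t (λ _ → var 1))) _ ⟩
  translate (incl c) (rename (λ _ → 1) t) [ (λ _ → w) ]
                                       ≈⟨ ≈-subst (translate-≈ c t[1]≈1) _ ⟩
  w                                    ∎
  where
    open import Relation.Binary.Reasoning.Setoid (≈-setoid U)
    ιt = translate (incl c) t

preimage : (ℕ → ℕ) → ℕ → ℕ → ℕ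
preimage g zero    z = 0
preimage g (suc k) z with g (suc k) ≟ z
... | yes _ = suc k
... | no  _ = preimage g k z

preimage-sound : ∀ g k z → 1 ≤ preimage g k z → g (preimage g k z) ≡ z
preimage-sound g (suc k) z 1≤h with g (suc k) ≟ z
... | yes gk≡z = gk≡z
... | no  _    = preimage-sound g k z 1≤h

preimage-inverse : ∀ g k {i} → ⟪ k ⟫ i → (∀ {a b} → ⟪ k ⟫ a → ⟪ k ⟫ b → g a ≡ g b → a ≡ b) →
  preimage g k (g i) ≡ i
preimage-inverse g zero    (s≤s z≤n , ()) _
preimage-inverse g (suc k) {i} (1≤i , i≤1+k) injective with g (suc k) ≟ g i
... | yes gk≡gi = injective (s≤s z≤n , ≤-refl) (1≤i , i≤1+k) gk≡gi
... | no  gk≢gi = preimage-inverse g k (1≤i , ≤-pred (≤∧≢⇒< i≤1+k (gk≢gi ∘ cong g ∘ sym)))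
  (λ (a₁ , a₂) (b₁ , b₂) → injective (a₁ , m≤n⇒m≤1+n a₂) (b₁ , m≤n⇒m≤1+n b₂))

rename-preimage : ∀ {T : Theory} (g : ℕ → ℕ) (m : ℕ) {t : Term (sig T)} → ⟪ m ⟫ ⊢ t →
  (∀ {a b} → ⟪ m ⟫ a → ⟪ m ⟫ b → g a ≡ g b → a ≡ b) →
  T ⊢ rename (preimage g m) (rename g t) ≈ t
rename-preimage g m {t} t-vars injective =
  ≈trans (subst-subst t _ _)
    (≈trans (subst-cong t (λ j j∈t →
               ≈-reflexive (cong var (preimage-inverse g m (t-vars j j∈t) injective))))
      (subst-var t))

separate : ∀ {T S : Theory} → Term (sig T) → (ℕ → Term (sig S)) → Separated T S
separate t s = record { X = varsOf t ; t = t ; tX = λ _ → varsOf-complete t ; s = s }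

⟦separate⟧-rename : ∀ {U T S} (cT : Contains U T) (cS : Contains U S) {u} t s →
  U ⊢ u ≈ ⟦ separate t s ⟧ cT cS → ∀ (ρ : ℕ → ℕ) →
  U ⊢ u [ var ∘ ρ ] ≈ ⟦ separate t (rename ρ ∘ s) ⟧ cT cS
⟦separate⟧-rename {U} cT cS {u} t s u≈ts ρ = begin
  u [ var ∘ ρ ]                          ≈⟨ ≈-subst u≈ts (var ∘ ρ) ⟩
  ιt [ ιS ∘ s ] [ var ∘ ρ ]              ≈⟨ subst-subst ιt _ _ ⟩
  ιt [ (λ x → ιS (s x) [ var ∘ ρ ]) ]
      ≈⟨ subst-cong ιt (λ x _ → ≈sym (translate-subst (incl cS) (s x) (var ∘ ρ))) ⟩
  ιt [ ιS ∘ rename ρ ∘ s ]               ∎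
  where
    open import Relation.Binary.Reasoning.Setoid (≈-setoid U)
    ιt = translate (incl cT) t
    ιS = translate (incl cS)

V5∧V6⇒Consistent : ∀ (V : Theory) (TV : Term (sig V) → Set) → Universal V TV → (v : Term (sig V)) →
  (∀ v' i → TV v' → V ⊢ var i ≈ v' → ｛ i ｝ ⊢ v') →
  (∀ v' → TV v' → V ⊢ v ≈ v' → ∀ i → ¬ (｛ i ｝ ⊢ v')) →
  Consistent V
V5∧V6⇒Consistent V TV universal v V5 V6 a b a≢b a≈b
  with universal (var a)
... | v' , v'∈TV , a≈v' = V6 v' v'∈TV v≈v' a (V5 v' a v'∈TV a≈v')
  where
    v-at-a : ℕ → Term (sig V)
    v-at-a z = if does (z ≟ a) then v else v'
    v≈v' : V ⊢ v ≈ v'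
    v≈v' = ≈trans (≈-reflexive (sym at-a)) (≈trans (≈-subst a≈b v-at-a) (≈-reflexive at-b))
      where
        at-a : v-at-a a ≡ v
        at-a = cong (if_then v else v') (dec-true (a ≟ a) refl)
        at-b : v-at-a b ≡ v'
        at-b = cong (if_then v else v') (dec-false (b ≟ a) (a≢b ∘ sym))

V5⇒rename-constant : ∀ (V : Theory) (TV : Term (sig V) → Set) → Stable V TV →
  (∀ v' i → TV v' → V ⊢ var i ≈ v' → ｛ i ｝ ⊢ v') →
  ∀ (g : ℕ → ℕ) {s i} → TV s → V ⊢ var i ≈ rename g s → ∀ {y} → y occursIn s → g y ≡ i
V5⇒rename-constant V TV stable V5 g {s} {i} s∈TV i≈sg {y} y∈s =
  V5 (rename g s) i (stable s g s∈TV) i≈sg (g y) (occursIn-rename⁺ g s y∈s)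

module UniqueSeparation {P V U : Theory} (cP : Contains U P) (cV : Contains U V)
  (unique : ∀ (st st' : Separated P V) (u : Term (sig U)) →
    U ⊢ u ≈ ⟦ st ⟧ cP cV → U ⊢ u ≈ ⟦ st' ⟧ cP cV → EqualModulo P V st st')
  where

  open import Relation.Binary.Reasoning.Setoid (≈-setoid V)

  -- V is consistent, so F' is injective on the variables of p and h undoes it there; hence
  -- p ≈ t[h ∘ F], and P6 bounds the variables of t[h ∘ F] (this is why t is taken from TP).
  components-of-p-are-variables : Consistent V → (TP : Term (sig P) → Set) → Stable P TP →
    (m : ℕ) (p : Term (sig P)) → ⟪ m ⟫ ⊢ p → (∀ p' → TP p' → P ⊢ p ≈ p' → ⟪ m ⟫ ⊢ p') →
    ∀ t s → TP t → U ⊢ translate (incl cP) p ≈ ⟦ separate t s ⟧ cP cV →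
    ∀ {x} → x occursIn t → ∃ λ i → ⟪ m ⟫ i × (V ⊢ var i ≈ s x)
  components-of-p-are-variables consistent TP stable m p p-vars P6 t s t∈TP p≈ts {x} x∈t
    with unique (separate t s) p-as-separated _ p≈ts (≈sym (subst-var _))
    where
      p-as-separated : Separated P V
      p-as-separated = record
        { X = upTo (suc m) ; t = p ; tX = λ i i∈p → ∈-upTo⁺ (s≤s (proj₂ (p-vars i i∈p))) ; s = var }
  ... | F , F' , s̄ , tF≈pF' , s≈s̄F , i≈s̄F' = i , i∈m , (begin
    var i       ≈⟨ i≈s̄F' i (∈-upTo⁺ (s≤s (proj₂ i∈m))) ⟩
    s̄ (F' i)    ≡⟨ cong s̄ (preimage-sound F' m (F x) (proj₁ i∈m)) ⟩
    s̄ (F x)     ≈⟨ ≈sym (s≈s̄F x (varsOf-complete t x∈t)) ⟩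
    s x         ∎)
    where
      F'-injective : ∀ {a b} → ⟪ m ⟫ a → ⟪ m ⟫ b → F' a ≡ F' b → a ≡ b
      F'-injective {a} {b} (_ , a≤m) (_ , b≤m) F'a≡F'b = decidable-stable (a ≟ b) λ a≢b →
        consistent a b a≢b (begin
          var a      ≈⟨ i≈s̄F' a (∈-upTo⁺ (s≤s a≤m)) ⟩
          s̄ (F' a)   ≡⟨ cong s̄ F'a≡F'b ⟩
          s̄ (F' b)   ≈⟨ ≈sym (i≈s̄F' b (∈-upTo⁺ (s≤s b≤m))) ⟩
          var b      ∎)
      h : ℕ → ℕ
      h = preimage F' m
      p≈t[h∘F] : P ⊢ p ≈ rename (h ∘ F) t
      p≈t[h∘F] = ≈trans (≈sym (rename-preimage F' m p-vars F'-injective))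
                   (≈trans (≈-subst (≈sym tF≈pF') (var ∘ h)) (subst-subst t _ _))
      i : ℕ
      i = h (F x)
      i∈m : ⟪ m ⟫ i
      i∈m = P6 _ (stable t (h ∘ F) t∈TP) p≈t[h∘F] i (occursIn-rename⁺ (h ∘ F) t x∈t)

  V-term-is-a-component : Consistent P → ∀ w t s → U ⊢ translate (incl cV) w ≈ ⟦ separate t s ⟧ cP cV →
    ∃ λ x → x occursIn t × (V ⊢ w ≈ s x)
  V-term-is-a-component consistent w t s w≈ts
    with unique (separate (var 1) (const w)) (separate t s) _ ≈refl w≈ts
  ... | F , F' , s̄ , 1F≈tF' , w≈s̄F , s≈s̄F'
    with any? (λ x → F' x ≟ F 1) (varsOf t)
  ... | no miss = ⊥-elim (Consistent⇒var≉ consistent F1∉tF' 1F≈tF')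
    where
      F1∉tF' : ¬ (F 1 occursIn rename F' t)
      F1∉tF' occ = let x , x∈t , F'x≡F1 = occursIn-rename⁻ F' t occ
                   in miss (lose (varsOf-complete t x∈t) F'x≡F1)
  ... | yes hit = let x , x∈t , F'x≡F1 = find hit in x , varsOf-sound t x∈t , (begin
    w           ≈⟨ w≈s̄F 1 (here refl) ⟩
    s̄ (F 1)     ≡⟨ cong s̄ (sym F'x≡F1) ⟩
    s̄ (F' x)    ≈⟨ ≈sym (s≈s̄F' x x∈t) ⟩
    s x         ∎)

module Grid (m : ℕ) (σ : ℕ → ℕ) where

  M : ℕ
  M = suc m

  cell : ℕ → ℕ → ℕ
  cell k i = i + k * M

  row column : ℕ → ℕ
  row z = z / M
  column z = z % M

  row-cell : ∀ k {i} → i < M → row (cell k i) ≡ k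
  row-cell k {i} i<M = trans (+-distrib-/-∣ʳ i (n∣m*n k)) (cong₂ _+_ (m<n⇒m/n≡0 i<M) (m*n/n≡m k M))

  column-cell : ∀ k {i} → i < M → column (cell k i) ≡ i
  column-cell k {i} i<M = trans ([m+kn]%n≡m%n i k M) (m<n⇒m%n≡m i<M)

  σ^ : Bool → ℕ → ℕ
  σ^ true  = σ
  σ^ false i = i

  twist : (ℕ → Bool) → ℕ → ℕ
  twist c z = σ^ (c (row z)) (column z)

  twist-cell : ∀ c k {i} → i < M → twist c (cell k i) ≡ σ^ (c k) i
  twist-cell c k i<M = cong₂ (σ^ ∘ c) (row-cell k i<M) (column-cell k i<M)

  -- Twist only the row of y: if y' lay in another row, σ would fix their common column.
  twist-constant⇒row-constant : (∀ i → 1 ≤ i → i ≤ m → σ i ≢ i) → (Y : ℕ → Set) →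
    (∀ c → ∃ λ i → ⟪ m ⟫ i × (∀ {y} → Y y → twist c y ≡ i)) →
    ∀ {y y'} → Y y → Y y' → row y ≡ row y'
  twist-constant⇒row-constant fixpoint-free Y twist-constant {y} {y'} y∈Y y'∈Y =
    decidable-stable (row y ≟ row y') λ rows-differ →
      let i₀ , (1≤i₀ , i₀≤m) , untwisted = twist-constant (const false)
          i₁ , _ , twisted = twist-constant c
      in fixpoint-free i₀ 1≤i₀ i₀≤m (begin
        σ i₀             ≡⟨ cong σ (sym (untwisted y∈Y)) ⟩
        σ (column y)     ≡⟨ cong (λ b → σ^ b (column y)) (sym (dec-true (row y ≟ row y) refl)) ⟩
        twist c y        ≡⟨ trans (twisted y∈Y) (sym (twisted y'∈Y)) ⟩
        twist c y'       ≡⟨ cong (λ b → σ^ b (column y')) (dec-false (row y' ≟ row y) (rows-differ ∘ sym)) ⟩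
        column y'        ≡⟨ untwisted y'∈Y ⟩
        i₀               ∎)
    where
      open ≡-Reasoning
      c : ℕ → Bool
      c k = does (k ≟ row y)

module GridTerm {P V U : Theory} (cP : Contains U P) (cV : Contains U V)
  (m : ℕ) (σ : ℕ → ℕ) (p : Term (sig P)) (p-vars : ⟪ m ⟫ ⊢ p) (v : Term (sig V)) where

  open Grid m σ
  open import Relation.Binary.Reasoning.Setoid (≈-setoid U)

  ιp : Term (sig U)
  ιp = translate (incl cP) p
  ιv : Term (sig U)
  ιv = translate (incl cV) v

  u : Term (sig U)
  u = ιv [ (λ k → ιp [ var ∘ cell k ]) ]

  ιp-vars : ∀ i → i occursIn ιp → i < M
  ιp-vars i i∈ιp = s≤s (proj₂ (p-vars i (occursIn-translate⁻ (incl cP) p i∈ιp)))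

  u-rename : ∀ ρ → U ⊢ u [ var ∘ ρ ] ≈ ιv [ (λ k → ιp [ var ∘ ρ ∘ cell k ]) ]
  u-rename ρ = ≈trans (subst-subst ιv _ _) (subst-cong ιv (λ k _ → subst-subst ιp _ _))

  u-twist : P ⊢ p ≈ rename σ p → V ⊢ rename (λ _ → 1) v ≈ var 1 →
    ∀ c → U ⊢ u [ var ∘ twist c ] ≈ ιp
  u-twist p≈pσ v-idempotent c = begin
    u [ var ∘ twist c ]                        ≈⟨ u-rename (twist c) ⟩
    ιv [ (λ k → ιp [ var ∘ twist c ∘ cell k ]) ] ≈⟨ subst-cong ιv (λ k _ → row-invariant k) ⟩
    ιv [ (λ _ → ιp) ]                          ≈⟨ translate-subst-const cV v v-idempotent ιp ⟩
    ιp                                         ∎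
    where
      ιp-σ^ : ∀ b → U ⊢ ιp [ var ∘ σ^ b ] ≈ ιp
      ιp-σ^ true  = ≈sym (≈trans (translate-≈ cP p≈pσ) (translate-subst (incl cP) p (var ∘ σ)))
      ιp-σ^ false = subst-var ιp
      row-invariant : ∀ k → U ⊢ ιp [ var ∘ twist c ∘ cell k ] ≈ ιp
      row-invariant k =
        ≈trans (subst-cong ιp (λ i i∈ιp → ≈-reflexive (cong var (twist-cell c k (ιp-vars i i∈ιp)))))
               (ιp-σ^ (c k))

  u-row : P ⊢ rename (λ _ → 1) p ≈ var 1 → U ⊢ u [ var ∘ row ] ≈ ιv
  u-row p-idempotent = begin
    u [ var ∘ row ]                        ≈⟨ u-rename row ⟩
    ιv [ (λ k → ιp [ var ∘ row ∘ cell k ]) ] ≈⟨ subst-cong ιv (λ k _ → row-collapses k) ⟩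
    ιv [ var ]                             ≈⟨ subst-var ιv ⟩
    ιv                                     ∎
    where
      row-collapses : ∀ k → U ⊢ ιp [ var ∘ row ∘ cell k ] ≈ var k
      row-collapses k =
        ≈trans (subst-cong ιp (λ i i∈ιp → ≈-reflexive (cong var (row-cell k (ιp-vars i i∈ιp)))))
               (translate-subst-const cP p p-idempotent (var k))

  twisted-separation : P ⊢ p ≈ rename σ p → V ⊢ rename (λ _ → 1) v ≈ var 1 →
    ∀ t s → U ⊢ u ≈ ⟦ separate t s ⟧ cP cV →
    ∀ c → U ⊢ ιp ≈ ⟦ separate t (rename (twist c) ∘ s) ⟧ cP cV
  twisted-separation p≈pσ v-idempotent t s u≈ts c =
    ≈trans (≈sym (u-twist p≈pσ v-idempotent c)) (⟦separate⟧-rename cP cV t s u≈ts (twist c))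

  collapsed-separation : P ⊢ rename (λ _ → 1) p ≈ var 1 →
    ∀ t s → U ⊢ u ≈ ⟦ separate t s ⟧ cP cV → U ⊢ ιv ≈ ⟦ separate t (rename row ∘ s) ⟧ cP cV
  collapsed-separation p-idempotent t s u≈ts =
    ≈trans (≈sym (u-row p-idempotent)) (⟦separate⟧-rename cP cV t s u≈ts row)

theorem3p13 :
  (P V : Theory) → Consistent P →
  (TP : Term (sig P) → Set) → Stable P TP → Universal P TP →
  (TV : Term (sig V) → Set) → Stable V TV → Universal V TV →
  (m : ℕ) (p : Term (sig P)) → ⟪ m ⟫ ⊢ p →
  (n : ℕ) (v : Term (sig V)) → ⟪ n ⟫ ⊢ v →
  -- (P4)
  (Σ (ℕ → ℕ) λ σ →
      (∀ i → 1 ≤ i → i ≤ m → (1 ≤ σ i) × (σ i ≤ m))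
    × (∀ i j → 1 ≤ i → i ≤ m → 1 ≤ j → j ≤ m → σ i ≡ σ j → i ≡ j)
    × (∀ i → 1 ≤ i → i ≤ m → σ i ≢ i)
    × (P ⊢ p ≈ rename σ p)) →
  -- (P5)
  (P ⊢ rename (λ _ → 1) p ≈ var 1) →
  -- (P6)
  (∀ p' → TP p' → P ⊢ p ≈ p' → ⟪ m ⟫ ⊢ p') →
  -- (V4)
  (V ⊢ rename (λ _ → 1) v ≈ var 1) →
  -- (V5)
  (∀ v' i → TV v' → V ⊢ var i ≈ v' → ｛ i ｝ ⊢ v') →
  -- (V6)
  (∀ v' → TV v' → V ⊢ v ≈ v' → ∀ i → ¬ (｛ i ｝ ⊢ v')) →
  ¬ (Σ Theory λ U → IsComposite U P V)
theorem3p13 P V consistentP TP stableP universalP TV stableV universalV m p p-vars _ v _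
  (σ , _ , _ , fixpoint-free , P4) P5 P6 V4 V5 V6 (U , cP , cV , separation , unique) =
  let st , u≈st = separation u
      t , t∈TP , tₛₜ≈t = universalP (Separated.t st)
      s = Separated.s st
      u≈ts : U ⊢ u ≈ ⟦ separate t s ⟧ cP cV
      u≈ts = ≈trans u≈st (≈-subst (translate-≈ cP tₛₜ≈t) _)
      x , x∈t , v≈sx[row] = V-term-is-a-component consistentP v t (rename row ∘ s)
                              (collapsed-separation P5 t s u≈ts)
      s' , s'∈TV , sx≈s' = universalV (s x)
      twist-constant-on-s' : ∀ c → ∃ λ i → ⟪ m ⟫ i × (∀ {y} → y occursIn s' → twist c y ≡ i)
      twist-constant-on-s' c =
        let i , i∈m , i≈sx[c] = components-of-p-are-variables consistentV TP stableP m p p-vars P6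
                                  t (rename (twist c) ∘ s) t∈TP (twisted-separation P4 V4 t s u≈ts c) x∈t
        in i , i∈m , V5⇒rename-constant V TV stableV V5 (twist c) s'∈TV (≈trans i≈sx[c] (≈-subst sx≈s' _))
      k , s'[row]⊢k = constant-rename⇒singleton row s'
                        (twist-constant⇒row-constant fixpoint-free (_occursIn s') twist-constant-on-s')
  in V6 (rename row s') (stableV s' row s'∈TV) (≈trans v≈sx[row] (≈-subst sx≈s' _)) k s'[row]⊢k
  where
    open Grid m σ
    open GridTerm cP cV m σ p p-vars v
    open UniqueSeparation cP cV unique
    consistentV : Consistent V
    consistentV = V5∧V6⇒Consistent V TV universalV v V5 V6
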